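{- Let $N\ge0$ be an integer. For all $m \geq 0$ and all $c_{0},\dots,c_N \in \mathbb{C}$, \[ \left(\frac{d}{dx}\right)^{m}\prod_{l=0}^{N}\ell_{l}(x)^{c_{l}}=\sum_{\substack{j_{0}+j_{1}+\cdots+j_{N}=m\\ j_0,\dots,j_N\ge0}}[j_{0},j_{1},\dots, j_{N}]_{1}(c_{0},\dots,c_N)\prod_{i=0}^{N}\ell_{i}(x)^{c_{i}-\alpha_{i}}, \] where $\alpha_{i}=j_{i}+\cdots+j_{N}$.
   Context: Let $\ell_{n}(x)$, $n \in \mathbb{Z}$, be commuting formal variables and let $\mathbb{C}\{[\ell]\}$ be the commutative algebra with basis all monomials $\prod_{i}\ell_{i}(x)^{r_{i}}$, $r_i\in\mathbb{C}$, almost all zero, multiplication adding exponents. Let $\frac{d}{dx}$ be the unique derivation with $\frac{d}{dx}\ell_{0}(x)^{r}=r\ell_{0}(x)^{r-1}$ and, for $n>0$, $\frac{d}{dx}\ell_{n}(x)^{r}=r\ell_{n}(x)^{r-1}\prod_{i=0}^{n-1}\ell_{i}(x)^{ -1}$, $\frac{d}{dx}\ell_{ -n}(x)^{r}=r\ell_{ -n}(x)^{r-1}\prod_{i=1}^{n}\ell_{ -i}(x)$. Tableaux of the first kind: a shape is a sequence of columns indexed $0,1,\dots,N$ from left to right with heights $m_0,\dots,m_N\ge0$. A tableau of this shape fills each position with a nonnegative integer such that (i) entries strictly increase going down each column, and (ii) an entry having $k$ entries above it in its own column, lying in a column $i$, is at most $k+(m_{i+1}+\cdots+m_N)$. The polynomial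 $[m_0,\dots,m_N]_1(x_0,\dots,x_N)$ is the sum over all tableaux of this shape of $\prod (x_i-e)$, the product over all entries $e$, with $i$ the index of the column containing $e$ (an empty product is $1$). -}

module Defs where

open import Level using (_⊔_)
open import Algebra.Bundles using (CommutativeRing)
open import Data.Nat as ℕ using (ℕ; zero; suc; _≡ᵇ_; _<ᵇ_; _≤ᵇ_)
open import Data.Integer as ℤ using (ℤ; +_; -[1+_]; +0; +[1+_])
open import Data.Bool using (Bool; true; false; _∧_; if_then_else_)
open import Data.Fin using (Fin; toℕ)
open import Data.List as L using (List; []; _∷_; [_]; _++_; concatMap; map; upTo; filterᵇ)
open import Data.Vec as V using (Vec)
open import Data.Product using (_×_; _,_)
open import Data.Nat.ListAction using () renaming (sum to sumℕ)

listsBelow : ℕ → ℕ → List (List ℕ)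
listsBelow zero    b = [ [] ]
listsBelow (suc n) b = concatMap (λ e → map (e ∷_) (listsBelow n b)) (upTo b)

vecsBelow : (n : ℕ) → ℕ → List (Vec ℕ n)
vecsBelow zero    b = V.[] ∷ []
vecsBelow (suc n) b = concatMap (λ e → map (e V.∷_) (vecsBelow n b)) (upTo b)

compositions : (n : ℕ) → ℕ → List (Vec ℕ n)
compositions n m = filterᵇ (λ j → V.sum j ≡ᵇ m) (vecsBelow n (suc m))

strictlyIncreasing : List ℕ → Bool
strictlyIncreasing (a ∷ b ∷ r) = (a <ᵇ b) ∧ strictlyIncreasing (b ∷ r)
strictlyIncreasing _           = true

-- the entry with k entries above it is at most k + B
-- (B = m_{i+1} + ⋯ + m_N); the first argument is the running k
boundedCol : ℕ → ℕ → List ℕ → Bool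
boundedCol B k []       = true
boundedCol B k (e ∷ es) = (e ≤ᵇ k ℕ.+ B) ∧ boundedCol B (suc k) es

validColumn : ℕ → List ℕ → Bool
validColumn B col = strictlyIncreasing col ∧ boundedCol B 0 col

-- all tableaux of the first kind of shape (m₀, …, m_N), a tableau being
-- the list of its columns (each column listed from top to bottom).
-- Candidates: all fillings with entries < mᵢ + B (every legal entry is
-- ≤ (mᵢ - 1) + B), filtered by conditions (i) and (ii).
tableaux : List ℕ → List (List (List ℕ))
tableaux []       = [ [] ]
tableaux (h ∷ hs) =
  concatMap (λ col → map (col ∷_) (tableaux hs))
            (filterᵇ (validColumn (sumℕ hs)) (listsBelow h (h ℕ.+ sumℕ hs)))

-- Everything over a commutative ring R (the paper: R = ℂ)

module _ {c ℓ} (R : CommutativeRing c ℓ) where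
  open CommutativeRing R

  natR : ℕ → Carrier
  natR zero    = 0#
  natR (suc n) = 1# + natR n

  tabWeight : List (List ℕ) → List Carrier → Carrier
  tabWeight (col ∷ cols) (x ∷ xs) =
    L.foldr (λ e acc → (x + - natR e) * acc) 1# col * tabWeight cols xs
  tabWeight _ _ = 1#

  bracket₁ : List ℕ → List Carrier → Carrier
  bracket₁ shape xs = L.foldr (λ t acc → tabWeight t xs + acc) 0# (tableaux shape)

  -- A monomial is written as a finite product of factors ℓ_k(x)^r,
  -- given as a list of pairs (k , r).  Its exponent at index k is the
  -- sum of the r's of the factors with index k; two such products denote
  -- the same basis monomial iff all exponents agree.
  Factor : Set c
  Factor = ℤ × Carrier

  Mono : Set c
  Mono = List Factor

  expo : Mono → ℤ → Carrier
  expo []            k = 0#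
  expo ((i , r) ∷ m) k = (if ⌊ i ≟ᶻ k ⌋ then r else 0#) + expo m k
    where
      open import Relation.Nullary.Decidable using (⌊_⌋)
      open import Data.Integer.Properties using () renaming (_≟_ to _≟ᶻ_)

  _≃ₘ_ : Mono → Mono → Set ℓ
  m ≃ₘ m' = ∀ k → expo m k ≈ expo m' k

  Elem : Set c
  Elem = List (Carrier × Mono)

  -- equality in the free R-module on the monomials
  infix 4 _≋_
  data _≋_ : Elem → Elem → Set (c ⊔ ℓ) where
    ≋-refl  : ∀ {xs} → xs ≋ xs
    ≋-sym   : ∀ {xs ys} → xs ≋ ys → ys ≋ xs
    ≋-trans : ∀ {xs ys zs} → xs ≋ ys → ys ≋ zs → xs ≋ zs
    ≋-cons  : ∀ {a a' m m' xs ys} → a ≈ a' → m ≃ₘ m' → xs ≋ ys →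
              ((a , m) ∷ xs) ≋ ((a' , m') ∷ ys)
    ≋-swap  : ∀ {t u xs} → (t ∷ u ∷ xs) ≋ (u ∷ t ∷ xs)
    ≋-merge : ∀ {a b m xs} → ((a , m) ∷ (b , m) ∷ xs) ≋ ((a + b , m) ∷ xs)
    ≋-zero  : ∀ {m xs} → ((0# , m) ∷ xs) ≋ xs

  dFactor : Factor → Carrier × Mono
  dFactor (+0 , r)       = r , ((+0 , r + - 1#) ∷ [])
  dFactor (+[1+ n ] , r) =
    r , ((+[1+ n ] , r + - 1#) ∷ map (λ i → (+ i , - 1#)) (upTo (suc n)))
  dFactor (-[1+ n ] , r) =
    r , ((-[1+ n ] , r + - 1#) ∷ map (λ i → (-[1+ i ] , 1#)) (upTo (suc n)))

  dMono : Mono → Elem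
  dMono []       = []
  dMono (f ∷ fs) with dFactor f
  ... | (a , mf) = (a , mf ++ fs) ∷ map (λ { (b , mb) → (b , f ∷ mb) }) (dMono fs)

  dElem : Elem → Elem
  dElem = concatMap (λ { (a , m) → map (λ { (b , mb) → (a * b , mb) }) (dMono m) })

  dPow : ℕ → Elem → Elem
  dPow zero    e = e
  dPow (suc n) e = dElem (dPow n e)

  lhsMono : ∀ {n} → Vec Carrier n → Mono
  lhsMono cs = V.toList (V.tabulate (λ i → (+ toℕ i , V.lookup cs i)))

  alpha : ∀ {n} → Vec ℕ n → Fin n → ℕ
  alpha j i = sumℕ (L.drop (toℕ i) (V.toList j))

  rhsMono : ∀ {n} → Vec Carrier n → Vec ℕ n → Mono
  rhsMono cs j =
    V.toList (V.tabulate (λ i → (+ toℕ i , V.lookup cs i + - natR (alpha j i))))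

  rhs : (n m : ℕ) → Vec Carrier n → Elem
  rhs n m cs =
    map (λ j → (bracket₁ (V.toList j) (V.toList cs) , rhsMono cs j))
        (compositions n m)

-- Write F(j) = [j₀,…,j_N]₁(c) and M(j) = ∏ᵢ ℓᵢ^(cᵢ − αᵢ(j)); the claim is proved by induction on m,
-- the step being d/dx Σ_{|j| = m} F(j) M(j) = Σ_{|y| = m+1} F(y) M(y).  As ℓᵢ'/ℓᵢ = ∏_{t ≤ i} ℓₜ⁻¹,
-- multiplying M(j) by it raises αₜ by one exactly for t ≤ i, so the Leibniz rule gives
-- d/dx M(j) = Σᵢ (cᵢ − αᵢ(j)) M(j + eᵢ).  Collecting terms, the step reduces to the recursion
-- F(y) = Σ_{i : yᵢ > 0} F(y − eᵢ) (cᵢ − αᵢ(y − eᵢ)).  The tableau sum factors over the columns,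
-- F(y) = ∏ᵢ C(cᵢ; yᵢ, α_{i+1}(y)), where C(x; h, B) sums ∏ₜ (x − eₜ) over e₀ < ⋯ < e_{h-1}
-- with eₜ ≤ t + B; splitting on whether the bottom entry takes its largest value gives
-- C(h+1, B+1) = C(h+1, B) + (x − h − B − 1) C(h, B+1) and C(h+1, 0) = (x − h) C(h, 0),
-- which is the recursion for the first column with F of the remaining columns factored out.
-- Because elements of ℂ{[ℓ]} are unnormalised lists of terms, one also checks that d/dx respects
-- their equality; this uses that the derivative of a monomial depends only on its exponents.

module Submission where

open import Defs
open import Level using (Level)
open import Algebra.Bundles using (CommutativeRing)
open import Data.Nat using (ℕ; suc)
open import Data.Vec using (Vec)
open import Data.Product using (_,_)
open import Data.List using (List; [_])

open import Level using (_⊔_)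
open import Data.Bool using (Bool; true; false; _∧_; T?; if_then_else_)
open import Data.Bool.Properties using (∧-assoc; ∧-zeroʳ)
open import Data.Nat as Nat using (zero; _≤_; _<_; z≤n; s≤s)
open import Data.Nat.Properties as Natₚ using (_≤?_)
open import Data.Nat.ListAction using () renaming (sum to sumℕ)
open import Data.Integer as ℤ using (ℤ; +[1+_]; -[1+_])
open import Data.Integer.Properties using () renaming (_≟_ to _≟ᶻ_)
open import Data.Fin as Fin using (Fin; toℕ)
open import Data.Fin.Properties using () renaming (_≤?_ to _≤ᶠ?_)
open import Data.Product using (_×_; proj₁; proj₂)
open import Data.Sum using (inj₁; inj₂)
open import Data.Vec as V using (_∷_; []; lookup; toList; tabulate)
import Data.Vec.Properties as Vₚ
open import Data.List as L using ([]; _∷_; _++_; map; concatMap; upTo; filterᵇ)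
import Data.List.Properties as Lₚ
open import Data.List.Membership.Propositional using (_∈_; find)
open import Data.List.Membership.Propositional.Properties
open import Data.List.Relation.Unary.Any as Any using (here; there)
import Data.List.Relation.Unary.All as All
open import Data.List.Relation.Unary.AllPairs using ([]; _∷_)
open import Data.List.Relation.Unary.Unique.Propositional using (Unique)
import Data.List.Relation.Unary.Unique.Propositional.Properties as Unique
open import Data.List.Relation.Unary.Unique.DecPropositional.Properties _≟ᶻ_ using (deduplicate-!)
open import Function using (id; _∘_)
open import Relation.Binary.Definitions using (DecidableEquality)
open import Relation.Binary.PropositionalEquality as ≡ using (_≡_)
open import Relation.Nullary using (¬_; Dec; does; yes; no; contradiction)
open import Relation.Nullary.Decidable using (isYes≗does)

module Compositions where
  open Nat using (_+_; pred)
  open ≡ using (refl; cong)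

  total : ∀ {n} → Vec ℕ n → ℕ
  total v = sumℕ (toList v)

  incAt : ∀ {n} → Fin n → Vec ℕ n → Vec ℕ n
  incAt Fin.zero    (x ∷ xs) = suc x ∷ xs
  incAt (Fin.suc i) (x ∷ xs) = x ∷ incAt i xs

  decAt : ∀ {n} → Fin n → Vec ℕ n → Vec ℕ n
  decAt Fin.zero    (x ∷ xs) = pred x ∷ xs
  decAt (Fin.suc i) (x ∷ xs) = x ∷ decAt i xs

  total-incAt : ∀ {n} (i : Fin n) j → total (incAt i j) ≡ suc (total j)
  total-incAt Fin.zero    (x ∷ j) = refl
  total-incAt (Fin.suc i) (x ∷ j) = ≡.trans (cong (x +_) (total-incAt i j)) (Natₚ.+-suc x (total j))

  lookup-incAt : ∀ {n} (i : Fin n) j → lookup (incAt i j) i ≡ suc (lookup j i)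
  lookup-incAt Fin.zero    (x ∷ j) = refl
  lookup-incAt (Fin.suc i) (x ∷ j) = lookup-incAt i j

  decAt-incAt : ∀ {n} (i : Fin n) j → decAt i (incAt i j) ≡ j
  decAt-incAt Fin.zero    (x ∷ j) = refl
  decAt-incAt (Fin.suc i) (x ∷ j) = cong (x ∷_) (decAt-incAt i j)

  incAt-decAt : ∀ {n} (i : Fin n) y {a} → lookup y i ≡ suc a → incAt i (decAt i y) ≡ y
  incAt-decAt Fin.zero    (suc x ∷ y) _ = refl
  incAt-decAt (Fin.suc i) (x ∷ y)     p = cong (x ∷_) (incAt-decAt i y p)

  total-decAt : ∀ {n} (i : Fin n) y {a b} → lookup y i ≡ suc a → total y ≡ suc b → total (decAt i y) ≡ b
  total-decAt i y p q =
    Natₚ.suc-injective (≡.trans (≡.sym (total-incAt i (decAt i y))) (≡.trans (cong total (incAt-decAt i y p)) q))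

  lookup≤total : ∀ {n} (v : Vec ℕ n) i → lookup v i ≤ total v
  lookup≤total (x ∷ v) Fin.zero    = Natₚ.m≤m+n x (total v)
  lookup≤total (x ∷ v) (Fin.suc i) = Natₚ.≤-trans (lookup≤total v i) (Natₚ.m≤n+m (total v) x)

  total-replicate : ∀ n → total (V.replicate n 0) ≡ 0
  total-replicate zero    = refl
  total-replicate (suc n) = total-replicate n


  sum≡total : ∀ {n} (v : Vec ℕ n) → V.sum v ≡ total v
  sum≡total []      = refl
  sum≡total (x ∷ v) = cong (x +_) (sum≡total v)

  ∈-vecsBelow : ∀ {n} b (v : Vec ℕ n) → (∀ i → lookup v i < b) → v ∈ vecsBelow n b
  ∈-vecsBelow b []      _ = here refl
  ∈-vecsBelow b (x ∷ v) p =
    ∈-concatMap⁺ (λ e → map (e ∷_) (vecsBelow _ b))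
      (Any.map (λ { refl → ∈-map⁺ (x ∷_) (∈-vecsBelow b v (λ i → p (Fin.suc i))) }) (∈-upTo⁺ (p Fin.zero)))

  private
    prefixed : ∀ {n} → List (Vec ℕ n) → List ℕ → List (Vec ℕ (suc n))
    prefixed vs = concatMap (λ e → map (e ∷_) vs)

    head∈ : ∀ {n} (vs : List (Vec ℕ n)) es {v} → v ∈ prefixed vs es → V.head v ∈ es
    head∈ vs (e ∷ es) p with ∈-++⁻ (map (e ∷_) vs) p
    ... | inj₂ q = there (head∈ vs es q)
    ... | inj₁ q with ∈-map⁻ (e ∷_) q
    ...   | _ , _ , refl = here refl

    prefixed-unique : ∀ {n} (vs : List (Vec ℕ n)) → Unique vs → ∀ es → Unique es → Unique (prefixed vs es)
    prefixed-unique vs _   []       _          = []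
    prefixed-unique vs uvs (e ∷ es) (e∉ ∷ ues) =
      Unique.++⁺ (Unique.map⁺ (λ { refl → refl }) uvs) (prefixed-unique vs uvs es ues) disjoint
      where
      disjoint : ∀ {v} → ¬ (v ∈ map (e ∷_) vs × v ∈ prefixed vs es)
      disjoint (p , q) with ∈-map⁻ (e ∷_) p
      ... | _ , _ , refl = All.lookup e∉ (head∈ vs es q) refl

  vecsBelow-unique : ∀ n b → Unique (vecsBelow n b)
  vecsBelow-unique zero    b = All.[] ∷ []
  vecsBelow-unique (suc n) b = prefixed-unique (vecsBelow n b) (vecsBelow-unique n b) (upTo b) (Unique.upTo⁺ b)

  compositions-unique : ∀ n m → Unique (compositions n m)
  compositions-unique n m = Unique.filter⁺ _ (vecsBelow-unique n (suc m))

  ∈-compositions⁺ : ∀ {n} m (v : Vec ℕ n) → total v ≡ m → v ∈ compositions n m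
  ∈-compositions⁺ m v refl =
    ∈-filter⁺ (λ x → T? (V.sum x Nat.≡ᵇ total v))
      (∈-vecsBelow (suc (total v)) v (λ i → s≤s (lookup≤total v i)))
      (Natₚ.≡⇒≡ᵇ (V.sum v) (total v) (sum≡total v))

  ∈-compositions⁻ : ∀ {n} m (v : Vec ℕ n) → v ∈ compositions n m → total v ≡ m
  ∈-compositions⁻ m v p =
    ≡.trans (≡.sym (sum≡total v))
      (Natₚ.≡ᵇ⇒≡ (V.sum v) m (proj₂ (∈-filter⁻ (λ x → T? (V.sum x Nat.≡ᵇ m)) {xs = vecsBelow _ (suc m)} p)))

  vecsBelow-one : ∀ n → vecsBelow n 1 ≡ [ V.replicate n 0 ]
  vecsBelow-one zero = refl
  vecsBelow-one (suc n) rewrite vecsBelow-one n = refl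

  compositions-zero : ∀ n → compositions n 0 ≡ [ V.replicate n 0 ]
  compositions-zero n
    rewrite vecsBelow-one n | sum≡total (V.replicate n 0) | total-replicate n = refl

module Expansion {c ℓ} (R : CommutativeRing c ℓ) where
  open CommutativeRing R hiding (zero)
  open import Algebra.Properties.Semiring.Sum semiring
    using (sum; sum-syntax; ∑-distrib-+; sum-cong-≋; sum-replicate-zero; *-distribˡ-sum)
  open import Algebra.Properties.Ring ring using (-‿+-comm; -0#≈0#)
  open import Algebra.Solver.Ring.NaturalCoefficients.Default commutativeSemiring
  open import Relation.Binary.Reasoning.Setoid setoid
  open Compositions
  open Nat using () renaming (_+_ to _+ℕ_)

  infix 4 _∼_ _≃_

  _∼_ : Elem R → Elem R → Set (c ⊔ ℓ)
  _∼_ = _≋_ R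

  _≃_ : Mono R → Mono R → Set ℓ
  _≃_ = _≃ₘ_ R

  ≃-refl : ∀ {m} → m ≃ m
  ≃-refl _ = refl

  x+[y+z]≈y+[x+z] : ∀ x y z → x + (y + z) ≈ y + (x + z)
  x+[y+z]≈y+[x+z] = solve 3 (λ x y z → x :+ (y :+ z) := y :+ (x :+ z)) refl

  -- A fold rather than a recursion, so that bracket₁ is literally a sumOver.
  sumOver : ∀ {a} {A : Set a} → (A → Carrier) → List A → Carrier
  sumOver f = L.foldr (λ x acc → f x + acc) 0#

  sumOver-cong : ∀ {a} {A : Set a} {f g : A → Carrier} xs → (∀ {x} → x ∈ xs → f x ≈ g x) →
                 sumOver f xs ≈ sumOver g xs
  sumOver-cong []       _ = refl
  sumOver-cong (x ∷ xs) p = +-cong (p (here ≡.refl)) (sumOver-cong xs (p ∘ there))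

  sumOver-zero : ∀ {a} {A : Set a} {f : A → Carrier} xs → (∀ {x} → x ∈ xs → f x ≈ 0#) → sumOver f xs ≈ 0#
  sumOver-zero []       _ = refl
  sumOver-zero (x ∷ xs) p = trans (+-cong (p (here ≡.refl)) (sumOver-zero xs (p ∘ there))) (+-identityˡ 0#)

  sumOver-++ : ∀ {a} {A : Set a} (f : A → Carrier) xs ys → sumOver f (xs ++ ys) ≈ sumOver f xs + sumOver f ys
  sumOver-++ f []       ys = sym (+-identityˡ _)
  sumOver-++ f (x ∷ xs) ys = trans (+-congˡ (sumOver-++ f xs ys)) (sym (+-assoc _ _ _))

  sumOver-concatMap : ∀ {a b} {A : Set a} {B : Set b} (f : B → Carrier) (g : A → List B) xs →
                      sumOver f (concatMap g xs) ≈ sumOver (λ x → sumOver f (g x)) xs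
  sumOver-concatMap f g []       = refl
  sumOver-concatMap f g (x ∷ xs) = trans (sumOver-++ f (g x) _) (+-congˡ (sumOver-concatMap f g xs))

  sumOver-map : ∀ {a b} {A : Set a} {B : Set b} (f : B → Carrier) (g : A → B) xs →
                sumOver f (map g xs) ≡ sumOver (f ∘ g) xs
  sumOver-map f g []       = ≡.refl
  sumOver-map f g (x ∷ xs) = ≡.cong (f (g x) +_) (sumOver-map f g xs)

  *-distribˡ-sumOver : ∀ {a} {A : Set a} k (f : A → Carrier) xs → sumOver (λ x → k * f x) xs ≈ k * sumOver f xs
  *-distribˡ-sumOver k f []       = sym (zeroʳ k)
  *-distribˡ-sumOver k f (x ∷ xs) = trans (+-congˡ (*-distribˡ-sumOver k f xs)) (sym (distribˡ k _ _))

  sumOver-filterᵇ : ∀ {a} {A : Set a} (p : A → Bool) (f : A → Carrier) xs →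
                    sumOver f (filterᵇ p xs) ≈ sumOver (λ x → if p x then f x else 0#) xs
  sumOver-filterᵇ p f []       = refl
  sumOver-filterᵇ p f (x ∷ xs) with p x
  ... | true  = +-congˡ (sumOver-filterᵇ p f xs)
  ... | false = trans (sumOver-filterᵇ p f xs) (sym (+-identityˡ _))

  *-distribʳ-sumOver : ∀ {a} {A : Set a} k (f : A → Carrier) xs → sumOver (λ x → f x * k) xs ≈ sumOver f xs * k
  *-distribʳ-sumOver k f []       = sym (zeroˡ k)
  *-distribʳ-sumOver k f (x ∷ xs) = trans (+-congˡ (*-distribʳ-sumOver k f xs)) (sym (distribʳ k _ _))

  sumOver-upTo : ∀ (f : ℕ → Carrier) n → sumOver f (upTo n) ≈ ∑[ t < n ] f (toℕ t)
  sumOver-upTo f n = reflexive (go n id)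
    where
    go : ∀ n (g : ℕ → ℕ) → sumOver f (L.applyUpTo g n) ≡ ∑[ t < n ] f (g (toℕ t))
    go zero    g = ≡.refl
    go (suc n) g = ≡.cong (f (g 0) +_) (go n (g ∘ suc))

  sumOver-tabulate : ∀ {a n} {A : Set a} (f : A → Carrier) (g : Fin n → A) →
                     sumOver f (toList (tabulate g)) ≡ ∑[ t < n ] f (g t)
  sumOver-tabulate {n = zero}  f g = ≡.refl
  sumOver-tabulate {n = suc n} f g = ≡.cong (f (g Fin.zero) +_) (sumOver-tabulate f (g ∘ Fin.suc))

  sumOver-∑ : ∀ {a n} {A : Set a} (f : A → Fin n → Carrier) xs →
              sumOver (λ x → ∑[ i < n ] f x i) xs ≈ ∑[ i < n ] sumOver (λ x → f x i) xs
  sumOver-∑ {n = n} f []       = sym (sum-replicate-zero n)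
  sumOver-∑ {n = n} f (x ∷ xs) = trans (+-congˡ (sumOver-∑ f xs)) (sym (∑-distrib-+ {n} _ _))

  infixr 7 [_]·_

  [_]·_ : ∀ {p} {P : Set p} → Dec P → Carrier → Carrier
  [ P? ]· v = if does P? then v else 0#

  []·-yes : ∀ {p} {P : Set p} (P? : Dec P) {v} → P → [ P? ]· v ≈ v
  []·-yes (yes _) _ = refl
  []·-yes (no ¬p) p = contradiction p ¬p

  []·-no : ∀ {p} {P : Set p} (P? : Dec P) {v} → ¬ P → [ P? ]· v ≈ 0#
  []·-no (yes p) ¬p = contradiction p ¬p
  []·-no (no _)  _  = refl

  []·-+ : ∀ {p} {P : Set p} (P? : Dec P) {u v} → [ P? ]· (u + v) ≈ [ P? ]· u + [ P? ]· v
  []·-+ (yes _) = refl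
  []·-+ (no _)  = sym (+-identityˡ 0#)

  []·-congʳ : ∀ {p} {P : Set p} (P? : Dec P) {u v} → u ≈ v → [ P? ]· u ≈ [ P? ]· v
  []·-congʳ (yes _) u≈v = u≈v
  []·-congʳ (no _)  _   = refl

  []·-⇔ : ∀ {p q} {P : Set p} {Q : Set q} (P? : Dec P) (Q? : Dec Q) {v} → (P → Q) → (Q → P) →
          [ P? ]· v ≈ [ Q? ]· v
  []·-⇔ (yes p) Q?      P→Q _   = sym ([]·-yes Q? (P→Q p))
  []·-⇔ (no ¬p) Q?      _   Q→P = sym ([]·-no Q? (¬p ∘ Q→P))

  sumOver-[]· : ∀ {a p} {A : Set a} {P : Set p} (P? : Dec P) (f : A → Carrier) xs →
                sumOver (λ x → [ P? ]· f x) xs ≈ [ P? ]· sumOver f xs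
  sumOver-[]· (yes _) f xs = refl
  sumOver-[]· (no _)  f xs = sumOver-zero xs (λ _ → refl)

  sumOver-single : ∀ {a b} {A : Set a} {Y : Set b} (_≟_ : DecidableEquality Y) (φ : A → Y) (g : A → Carrier) {y z} →
                   ∀ xs → Unique xs → z ∈ xs → φ z ≡ y → (∀ {x} → φ x ≡ y → x ≡ z) →
                   sumOver (λ x → [ φ x ≟ y ]· g x) xs ≈ g z
  sumOver-single _≟_ φ g (x ∷ xs) (x∉ ∷ _) (here ≡.refl) φz≡y unique =
    trans (+-cong ([]·-yes (φ x ≟ _) φz≡y)
                  (sumOver-zero xs (λ x'∈ → []·-no (φ _ ≟ _) (λ φx'≡y → All.lookup x∉ x'∈ (≡.sym (unique φx'≡y))))))
          (+-identityʳ _)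
  sumOver-single _≟_ φ g (x ∷ xs) (x∉ ∷ u) (there z∈) φz≡y unique =
    trans (+-cong ([]·-no (φ x ≟ _) (λ φx≡y → All.lookup x∉ z∈ (unique φx≡y)))
                  (sumOver-single _≟_ φ g xs u z∈ φz≡y unique))
          (+-identityˡ _)

  ∼-reflexive : ∀ {xs ys} → xs ≡ ys → xs ∼ ys
  ∼-reflexive ≡.refl = ≋-refl

  ∼-∷ : ∀ {a a' m xs ys} → a ≈ a' → xs ∼ ys → (a , m) ∷ xs ∼ (a' , m) ∷ ys
  ∼-∷ {m = m} p q = ≋-cons p (≃-refl {m}) q

  ∼-++ˡ : ∀ {xs xs'} ys → xs ∼ xs' → xs ++ ys ∼ xs' ++ ys
  ∼-++ˡ ys ≋-refl          = ≋-refl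
  ∼-++ˡ ys (≋-sym p)       = ≋-sym (∼-++ˡ ys p)
  ∼-++ˡ ys (≋-trans p q)   = ≋-trans (∼-++ˡ ys p) (∼-++ˡ ys q)
  ∼-++ˡ ys (≋-cons a m p)  = ≋-cons a m (∼-++ˡ ys p)
  ∼-++ˡ ys ≋-swap          = ≋-swap
  ∼-++ˡ ys ≋-merge         = ≋-merge
  ∼-++ˡ ys ≋-zero          = ≋-zero

  ∼-++ʳ : ∀ xs {ys ys'} → ys ∼ ys' → xs ++ ys ∼ xs ++ ys'
  ∼-++ʳ []             p = p
  ∼-++ʳ ((a , m) ∷ xs) p = ∼-∷ refl (∼-++ʳ xs p)

  ∼-++ : ∀ {xs xs' ys ys'} → xs ∼ xs' → ys ∼ ys' → xs ++ ys ∼ xs' ++ ys'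
  ∼-++ {xs' = xs'} {ys} p q = ≋-trans (∼-++ˡ ys p) (∼-++ʳ xs' q)

  ∼-shift : ∀ t xs ys → t ∷ (xs ++ ys) ∼ xs ++ (t ∷ ys)
  ∼-shift t []       ys = ≋-refl
  ∼-shift t (u ∷ xs) ys = ≋-trans ≋-swap (∼-++ʳ L.[ u ] (∼-shift t xs ys))

  ∼-++-comm : ∀ xs ys → xs ++ ys ∼ ys ++ xs
  ∼-++-comm []       ys = ∼-reflexive (≡.sym (Lₚ.++-identityʳ ys))
  ∼-++-comm (x ∷ xs) ys = ≋-trans (∼-++ʳ L.[ x ] (∼-++-comm xs ys)) (∼-shift x ys xs)

  map-∼ : ∀ {a} {A : Set a} (xs : List A) {f g : A → Carrier} {G H : A → Mono R} →
          (∀ {x} → x ∈ xs → f x ≈ g x) → (∀ {x} → x ∈ xs → G x ≃ H x) →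
          map (λ x → (f x , G x)) xs ∼ map (λ x → (g x , H x)) xs
  map-∼ []       p q = ≋-refl
  map-∼ (x ∷ xs) p q = ≋-cons (p (here ≡.refl)) (q (here ≡.refl)) (map-∼ xs (p ∘ there) (q ∘ there))

  map-∼-zero : ∀ {a} {A : Set a} (xs : List A) {f : A → Carrier} {G : A → Mono R} →
               (∀ {x} → x ∈ xs → f x ≈ 0#) → map (λ x → (f x , G x)) xs ∼ []
  map-∼-zero []       p = ≋-refl
  map-∼-zero (x ∷ xs) p = ≋-trans (∼-∷ (p (here ≡.refl)) (map-∼-zero xs (p ∘ there))) ≋-zero

  concatMap-∼ : ∀ {a} {A : Set a} (xs : List A) {f g : A → Elem R} → (∀ {x} → x ∈ xs → f x ∼ g x) →
                concatMap f xs ∼ concatMap g xs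
  concatMap-∼ []       p = ≋-refl
  concatMap-∼ (x ∷ xs) p = ∼-++ (p (here ≡.refl)) (concatMap-∼ xs (p ∘ there))

  module _ {a b} {A : Set a} {Y : Set b} (_≟_ : DecidableEquality Y)
           (key : A → Y) (f : A → Carrier) (G : Y → Mono R) where

    coefficientOf : List A → Y → Carrier
    coefficientOf xs y = sumOver (λ x → [ key x ≟ y ]· f x) xs

    private
      insert : ∀ ys → Unique ys → ∀ {k} → k ∈ ys → (v : Carrier) (h : Y → Carrier) →
               (v , G k) ∷ map (λ y → (h y , G y)) ys ∼ map (λ y → ([ k ≟ y ]· v + h y , G y)) ys
      insert (y ∷ ys) (y∉ ∷ u) (here ≡.refl) v h =
        ≋-trans ≋-merge (∼-∷ (+-congʳ (sym ([]·-yes (y ≟ y) ≡.refl)))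
          (map-∼ ys (λ y'∈ → sym (trans (+-congʳ ([]·-no (y ≟ _) (All.lookup y∉ y'∈))) (+-identityˡ _)))
                    (λ {y'} _ → ≃-refl {G y'})))
      insert (y ∷ ys) (y∉ ∷ u) (there k∈) v h =
        ≋-trans ≋-swap (∼-∷ (sym (trans (+-congʳ ([]·-no (_ ≟ y) (λ k≡y → All.lookup y∉ k∈ (≡.sym k≡y))))
                                        (+-identityˡ _)))
                           (insert ys u k∈ v h))

    collect : ∀ ys → Unique ys → ∀ xs → (∀ {x} → x ∈ xs → key x ∈ ys) →
              map (λ x → (f x , G (key x))) xs ∼ map (λ y → (coefficientOf xs y , G y)) ys
    collect ys u []       _   = ≋-sym (map-∼-zero ys (λ _ → refl))
    collect ys u (x ∷ xs) mem =
      ≋-trans (∼-++ʳ L.[ _ ] (collect ys u xs (mem ∘ there))) (insert ys u (mem (here ≡.refl)) (f x) (coefficientOf xs))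

  scale : Carrier → Elem R → Elem R
  scale a = map (λ t → (a * proj₁ t , proj₂ t))

  scale-cong : ∀ a {xs ys} → xs ∼ ys → scale a xs ∼ scale a ys
  scale-cong a ≋-refl         = ≋-refl
  scale-cong a (≋-sym p)      = ≋-sym (scale-cong a p)
  scale-cong a (≋-trans p q)  = ≋-trans (scale-cong a p) (scale-cong a q)
  scale-cong a (≋-cons b m p) = ≋-cons (*-congˡ b) m (scale-cong a p)
  scale-cong a ≋-swap         = ≋-swap
  scale-cong a ≋-merge        = ≋-trans ≋-merge (∼-∷ (sym (distribˡ a _ _)) ≋-refl)
  scale-cong a ≋-zero         = ≋-trans (∼-∷ (zeroʳ a) ≋-refl) ≋-zero

  scale-congˡ : ∀ {a b} xs → a ≈ b → scale a xs ∼ scale b xs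
  scale-congˡ []       p = ≋-refl
  scale-congˡ (x ∷ xs) p = ∼-∷ (*-congʳ p) (scale-congˡ xs p)

  scale-+ : ∀ a b xs → scale a xs ++ scale b xs ∼ scale (a + b) xs
  scale-+ a b []       = ≋-refl
  scale-+ a b (x ∷ xs) =
    ≋-trans (∼-++ʳ [ _ ] (≋-sym (∼-shift _ (scale a xs) (scale b xs))))
            (≋-trans ≋-merge (∼-∷ (sym (distribʳ _ a b)) (scale-+ a b xs)))

  scale-zero : ∀ xs → scale 0# xs ∼ []
  scale-zero []       = ≋-refl
  scale-zero (x ∷ xs) = ≋-trans (∼-∷ (zeroˡ _) (scale-zero xs)) ≋-zero

  prepend : Factor R → Elem R → Elem R
  prepend f = map (λ t → (proj₁ t , f ∷ proj₂ t))

  expo-++ : ∀ m m' k → expo R (m ++ m') k ≈ expo R m k + expo R m' k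
  expo-++ []      m' k = sym (+-identityˡ _)
  expo-++ (f ∷ m) m' k = trans (+-congˡ (expo-++ m m' k)) (sym (+-assoc _ _ _))

  expo-∷ : ∀ i r m k → expo R ((i , r) ∷ m) k ≈ [ i ≟ᶻ k ]· r + expo R m k
  expo-∷ i r m k = +-congʳ (reflexive (≡.cong (λ b → if b then r else 0#) (isYes≗does (i ≟ᶻ k))))

  expo≈sumOver : ∀ m k → expo R m k ≈ sumOver (λ f → [ proj₁ f ≟ᶻ k ]· proj₂ f) m
  expo≈sumOver []            k = refl
  expo≈sumOver ((i , r) ∷ m) k = trans (expo-∷ i r m k) (+-congˡ (expo≈sumOver m k))

  ≃-++ : ∀ {m m' n n'} → m ≃ m' → n ≃ n' → m ++ n ≃ m' ++ n'
  ≃-++ {m} {m'} {n} {n'} p q k = trans (expo-++ m n k) (trans (+-cong (p k) (q k)) (sym (expo-++ m' n' k)))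

  prepend-cong : ∀ f {xs ys} → xs ∼ ys → prepend f xs ∼ prepend f ys
  prepend-cong f ≋-refl         = ≋-refl
  prepend-cong f (≋-sym p)      = ≋-sym (prepend-cong f p)
  prepend-cong f (≋-trans p q)  = ≋-trans (prepend-cong f p) (prepend-cong f q)
  prepend-cong f (≋-cons a m p) = ≋-cons a (λ k → +-congˡ (m k)) (prepend-cong f p)
  prepend-cong f ≋-swap         = ≋-swap
  prepend-cong f ≋-merge        = ≋-merge
  prepend-cong f ≋-zero         = ≋-zero

  -- dℓ k is the monomial ℓ_k'(x), and ℓ_k(x)^r has derivative r · ℓ_k(x)^r · dlogℓ k.
  dℓ : ℤ → Mono R
  dℓ (ℤ.+ n)    = map (λ i → (ℤ.+ i , - 1#)) (upTo n)
  dℓ -[1+ n ] = map (λ i → (-[1+ i ] , 1#)) (upTo (suc n))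

  dlogℓ : ℤ → Mono R
  dlogℓ k = (k , - 1#) ∷ dℓ k

  dFactor≡ : ∀ k r → dFactor R (k , r) ≡ (r , (k , r + - 1#) ∷ dℓ k)
  dFactor≡ (ℤ.+ zero)  r = ≡.refl
  dFactor≡ +[1+ n ]  r = ≡.refl
  dFactor≡ -[1+ n ]  r = ≡.refl

  leibniz : Mono R → Elem R
  leibniz m = map (λ f → (proj₂ f , dlogℓ (proj₁ f) ++ m)) m

  private
    prepend-leibniz : ∀ f fs m → prepend f (map (λ g → (proj₂ g , dlogℓ (proj₁ g) ++ m)) fs)
                                 ∼ map (λ g → (proj₂ g , dlogℓ (proj₁ g) ++ f ∷ m)) fs
    prepend-leibniz f []       m = ≋-refl
    prepend-leibniz f (g ∷ fs) m = ≋-cons refl shift (prepend-leibniz f fs m)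
      where
      shift : f ∷ dlogℓ (proj₁ g) ++ m ≃ dlogℓ (proj₁ g) ++ f ∷ m
      shift k = begin
          expo R (f ∷ dlogℓ (proj₁ g) ++ m) k
        ≈⟨ +-congˡ (expo-++ (dlogℓ (proj₁ g)) m k) ⟩
          _ + (expo R (dlogℓ (proj₁ g)) k + expo R m k)
        ≈⟨ x+[y+z]≈y+[x+z] _ _ _ ⟩
          expo R (dlogℓ (proj₁ g)) k + expo R (f ∷ m) k
        ≈⟨ sym (expo-++ (dlogℓ (proj₁ g)) (f ∷ m) k) ⟩
          expo R (dlogℓ (proj₁ g) ++ f ∷ m) k ∎

  dMono-leibniz : ∀ m → dMono R m ∼ leibniz m
  dMono-leibniz [] = ≋-refl
  dMono-leibniz ((k , r) ∷ fs) rewrite dFactor≡ k r =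
    ≋-cons refl first (≋-trans (prepend-cong (k , r) (dMono-leibniz fs)) (prepend-leibniz (k , r) fs fs))
    where
    first : (k , r + - 1#) ∷ dℓ k ++ fs ≃ dlogℓ k ++ (k , r) ∷ fs
    first y = begin
        expo R ((k , r + - 1#) ∷ dℓ k ++ fs) y
      ≈⟨ expo-∷ k _ (dℓ k ++ fs) y ⟩
        [k]· (r + - 1#) + expo R (dℓ k ++ fs) y
      ≈⟨ +-cong ([]·-+ (k ≟ᶻ y)) (expo-++ (dℓ k) fs y) ⟩
        ([k]· r + [k]· (- 1#)) + (expo R (dℓ k) y + expo R fs y)
      ≈⟨ solve 4 (λ a b e g → (a :+ b) :+ (e :+ g) := b :+ (e :+ (a :+ g))) refl _ _ _ _ ⟩
        [k]· (- 1#) + (expo R (dℓ k) y + ([k]· r + expo R fs y))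
      ≈⟨ +-congˡ (sym (trans (expo-++ (dℓ k) ((k , r) ∷ fs) y) (+-congˡ (expo-∷ k r fs y)))) ⟩
        [k]· (- 1#) + expo R (dℓ k ++ (k , r) ∷ fs) y
      ≈⟨ sym (expo-∷ k _ (dℓ k ++ (k , r) ∷ fs) y) ⟩
        expo R (dlogℓ k ++ (k , r) ∷ fs) y ∎
      where
      [k]·_ : Carrier → Carrier
      [k]· v = [ k ≟ᶻ y ]· v

  leibniz-collect : ∀ m ks → Unique ks → (∀ {f} → f ∈ m → proj₁ f ∈ ks) →
                    leibniz m ∼ map (λ k → (expo R m k , dlogℓ k ++ m)) ks
  leibniz-collect m ks u mem =
    ≋-trans (collect _≟ᶻ_ proj₁ proj₂ G ks u m mem)
            (map-∼ ks (λ {k} _ → sym (expo≈sumOver m k)) (λ {k} _ → ≃-refl {G k}))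
    where
    G : ℤ → Mono R
    G k = dlogℓ k ++ m

  dMono-cong : ∀ {m m'} → m ≃ m' → dMono R m ∼ dMono R m'
  dMono-cong {m} {m'} m≃m' =
    ≋-trans (dMono-leibniz m) (≋-trans (leibniz-collect m ks u (λ f∈ → mem (∈-++⁺ˡ f∈)))
      (≋-trans (map-∼ ks (λ {k} _ → m≃m' k) (λ {k} _ → ≃-++ {dlogℓ k} {dlogℓ k} {m} {m'} (≃-refl {dlogℓ k}) m≃m'))
        (≋-sym (≋-trans (dMono-leibniz m') (leibniz-collect m' ks u (λ f∈ → mem (∈-++⁺ʳ m f∈)))))))
    where
    ks = L.deduplicate _≟ᶻ_ (map proj₁ (m ++ m'))
    u  = deduplicate-! (map proj₁ (m ++ m'))
    mem : ∀ {f} → f ∈ m ++ m' → proj₁ f ∈ ks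
    mem f∈ = ∈-deduplicate⁺ _≟ᶻ_ (∈-map⁺ proj₁ f∈)

  dElem-cong : ∀ {xs ys} → xs ∼ ys → dElem R xs ∼ dElem R ys
  dElem-cong ≋-refl                 = ≋-refl
  dElem-cong (≋-sym p)              = ≋-sym (dElem-cong p)
  dElem-cong (≋-trans p q)          = ≋-trans (dElem-cong p) (dElem-cong q)
  dElem-cong (≋-cons {a' = a'} a m p) =
    ∼-++ (≋-trans (scale-congˡ _ a) (scale-cong a' (dMono-cong m))) (dElem-cong p)
  dElem-cong (≋-swap {t} {u} {xs})  =
    ≡.subst₂ _∼_ (Lₚ.++-assoc A B Z) (Lₚ.++-assoc B A Z) (∼-++ˡ Z (∼-++-comm A B))
    where
    A = scale (proj₁ t) (dMono R (proj₂ t))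
    B = scale (proj₁ u) (dMono R (proj₂ u))
    Z = dElem R xs
  dElem-cong (≋-merge {a} {b} {m} {xs}) =
    ≡.subst (_∼ scale (a + b) (dMono R m) ++ dElem R xs) (Lₚ.++-assoc (scale a (dMono R m)) _ _)
      (∼-++ˡ (dElem R xs) (scale-+ a b (dMono R m)))
  dElem-cong (≋-zero {m} {xs})      = ∼-++ˡ (dElem R xs) (scale-zero (dMono R m))

  infixl 6 _-ₙ_

  _-ₙ_ : Carrier → ℕ → Carrier
  x -ₙ e = x + - natR R e

  -ₙ-congʳ : ∀ x {d e} → d ≡ e → x -ₙ d ≈ x -ₙ e
  -ₙ-congʳ x d≡e = reflexive (≡.cong (x -ₙ_) d≡e)

  -1+[x-ₙa]≈x-ₙ1+a : ∀ x a → - 1# + (x -ₙ a) ≈ x -ₙ suc a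
  -1+[x-ₙa]≈x-ₙ1+a x a = trans (x+[y+z]≈y+[x+z] _ _ _) (+-congˡ (-‿+-comm 1# (natR R a)))

  indices : ∀ n → List (Fin n)
  indices n = toList (V.allFin n)

  toList-tabulate : ∀ {a n} {A : Set a} (f : Fin n → A) → toList (tabulate f) ≡ map f (indices n)
  toList-tabulate {n = n} f = ≡.trans (≡.cong toList (Vₚ.tabulate-allFin f)) (Vₚ.toList-map f (V.allFin n))

  diagonal : ∀ {n} → (Fin n → Carrier) → Mono R
  diagonal v = toList (tabulate (λ t → (ℤ.+ toℕ t , v t)))

  expo-diagonal : ∀ {n} (v : Fin n → Carrier) k → expo R (diagonal v) k ≈ ∑[ t < n ] ([ ℤ.+ toℕ t ≟ᶻ k ]· v t)
  expo-diagonal v k =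
    trans (expo≈sumOver (diagonal v) k)
          (reflexive (sumOver-tabulate (λ f → [ proj₁ f ≟ᶻ k ]· proj₂ f) (λ t → (ℤ.+ toℕ t , v t))))

  diagonal-cong : ∀ {n} {u v : Fin n → Carrier} → (∀ t → u t ≈ v t) → diagonal u ≃ diagonal v
  diagonal-cong {u = u} {v} u≈v k =
    trans (expo-diagonal u k) (trans (sum-cong-≋ (λ t → []·-congʳ (ℤ.+ toℕ t ≟ᶻ k) (u≈v t))) (sym (expo-diagonal v k)))

  ∑-≤ : ∀ {n} (i : Fin n) (h : ℕ → Carrier) →
        ∑[ t < n ] ([ t ≤ᶠ? i ]· h (toℕ t)) ≈ h (toℕ i) + ∑[ q < toℕ i ] h (toℕ q)
  ∑-≤ {suc n} Fin.zero    h =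
    +-cong ([]·-yes (Fin.zero {n} ≤ᶠ? Fin.zero {n}) z≤n)
           (trans (sum-cong-≋ {n} (λ t → []·-no (Fin.suc t ≤ᶠ? Fin.zero {n}) {h (suc (toℕ t))} λ ())) (sum-replicate-zero n))
  ∑-≤ {suc n} (Fin.suc i) h = begin
      [ Fin.zero {n} ≤ᶠ? Fin.suc i ]· h 0 + ∑[ t < n ] ([ Fin.suc t ≤ᶠ? Fin.suc i ]· h (suc (toℕ t)))
    ≈⟨ +-cong ([]·-yes (Fin.zero {n} ≤ᶠ? Fin.suc i) z≤n)
              (sum-cong-≋ {n} (λ t → []·-⇔ (Fin.suc t ≤ᶠ? Fin.suc i) (t ≤ᶠ? i) Natₚ.≤-pred s≤s)) ⟩
      h 0 + ∑[ t < n ] ([ t ≤ᶠ? i ]· h (suc (toℕ t)))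
    ≈⟨ +-congˡ (∑-≤ i (h ∘ suc)) ⟩
      h 0 + (h (suc (toℕ i)) + ∑[ q < toℕ i ] h (suc (toℕ q)))
    ≈⟨ x+[y+z]≈y+[x+z] _ _ _ ⟩
      h (suc (toℕ i)) + (h 0 + ∑[ q < toℕ i ] h (suc (toℕ q))) ∎

  expo-dlogℓ : ∀ {n} (i : Fin n) k →
               expo R (dlogℓ (ℤ.+ toℕ i)) k ≈ ∑[ t < n ] ([ t ≤ᶠ? i ]· [ ℤ.+ toℕ t ≟ᶻ k ]· - 1#)
  expo-dlogℓ {n} i k = begin
      expo R (dlogℓ (ℤ.+ toℕ i)) k
    ≈⟨ expo-∷ (ℤ.+ toℕ i) (- 1#) (dℓ (ℤ.+ toℕ i)) k ⟩
      [ ℤ.+ toℕ i ≟ᶻ k ]· - 1# + expo R (dℓ (ℤ.+ toℕ i)) k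
    ≈⟨ +-congˡ (expo≈sumOver (dℓ (ℤ.+ toℕ i)) k) ⟩
      [ ℤ.+ toℕ i ≟ᶻ k ]· - 1#
        + sumOver (λ f → [ proj₁ f ≟ᶻ k ]· proj₂ f) (map (λ q → (ℤ.+ q , - 1#)) (upTo (toℕ i)))
    ≈⟨ +-congˡ (reflexive (sumOver-map _ _ (upTo (toℕ i)))) ⟩
      [ ℤ.+ toℕ i ≟ᶻ k ]· - 1# + sumOver (λ q → [ ℤ.+ q ≟ᶻ k ]· - 1#) (upTo (toℕ i))
    ≈⟨ +-congˡ (sumOver-upTo _ (toℕ i)) ⟩
      [ ℤ.+ toℕ i ≟ᶻ k ]· - 1# + ∑[ q < toℕ i ] ([ ℤ.+ toℕ q ≟ᶻ k ]· - 1#)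
    ≈⟨ sym (∑-≤ i (λ q → [ ℤ.+ q ≟ᶻ k ]· - 1#)) ⟩
      ∑[ t < n ] ([ t ≤ᶠ? i ]· [ ℤ.+ toℕ t ≟ᶻ k ]· - 1#) ∎

  alpha-incAt-≤ : ∀ {n} {i t : Fin n} j → t Fin.≤ i → alpha R (incAt i j) t ≡ suc (alpha R j t)
  alpha-incAt-≤ {i = i}       {Fin.zero}  j       _         = total-incAt i j
  alpha-incAt-≤ {i = Fin.suc i} {Fin.suc t} (x ∷ j) (s≤s t≤i) = alpha-incAt-≤ j t≤i

  alpha-incAt-≰ : ∀ {n} {i t : Fin n} j → ¬ t Fin.≤ i → alpha R (incAt i j) t ≡ alpha R j t
  alpha-incAt-≰ {t = Fin.zero}                j       t≰i = contradiction z≤n t≰i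
  alpha-incAt-≰ {i = Fin.zero}  {Fin.suc t} (x ∷ j) _   = ≡.refl
  alpha-incAt-≰ {i = Fin.suc i} {Fin.suc t} (x ∷ j) t≰i = alpha-incAt-≰ j (t≰i ∘ s≤s)

  alpha-replicate : ∀ {n} (t : Fin n) → alpha R (V.replicate n 0) t ≡ 0
  alpha-replicate {suc n} Fin.zero    = total-replicate n
  alpha-replicate {suc n} (Fin.suc t) = alpha-replicate t

  lhsMono≃rhsMono : ∀ {n} (cs : Vec Carrier n) → lhsMono R cs ≃ rhsMono R cs (V.replicate n 0)
  lhsMono≃rhsMono {n} cs = diagonal-cong {n} {lookup cs} λ t →
    sym (trans (+-congˡ (trans (-‿cong (reflexive (≡.cong (natR R) (alpha-replicate t)))) -0#≈0#)) (+-identityʳ _))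

  dlogℓ-rhsMono : ∀ {n} (cs : Vec Carrier n) i j → dlogℓ (ℤ.+ toℕ i) ++ rhsMono R cs j ≃ rhsMono R cs (incAt i j)
  dlogℓ-rhsMono {n} cs i j k = begin
      expo R (dlogℓ (ℤ.+ toℕ i) ++ rhsMono R cs j) k
    ≈⟨ expo-++ (dlogℓ (ℤ.+ toℕ i)) (rhsMono R cs j) k ⟩
      expo R (dlogℓ (ℤ.+ toℕ i)) k + expo R (rhsMono R cs j) k
    ≈⟨ +-cong (expo-dlogℓ i k) (expo-diagonal (exponent j) k) ⟩
      ∑[ t < n ] ([ t ≤ᶠ? i ]· [ t≟k t ]· - 1#) + ∑[ t < n ] ([ t≟k t ]· exponent j t)
    ≈⟨ sym (∑-distrib-+ {n} _ _) ⟩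
      ∑[ t < n ] ([ t ≤ᶠ? i ]· [ t≟k t ]· - 1# + [ t≟k t ]· exponent j t)
    ≈⟨ sum-cong-≋ {n} raise ⟩
      ∑[ t < n ] ([ t≟k t ]· exponent (incAt i j) t)
    ≈⟨ sym (expo-diagonal (exponent (incAt i j)) k) ⟩
      expo R (rhsMono R cs (incAt i j)) k ∎
    where
    t≟k : ∀ t → Dec (ℤ.+ toℕ t ≡ k)
    t≟k t = ℤ.+ toℕ t ≟ᶻ k
    exponent : Vec ℕ n → Fin n → Carrier
    exponent j t = lookup cs t -ₙ alpha R j t
    raise : ∀ t → [ t ≤ᶠ? i ]· [ t≟k t ]· - 1# + [ t≟k t ]· exponent j t ≈ [ t≟k t ]· exponent (incAt i j) t
    raise t with t ≤ᶠ? i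
    ... | no  t≰i = begin
        [ t ≤ᶠ? i ]· [ t≟k t ]· - 1# + [ t≟k t ]· exponent j t
      ≈⟨ trans (+-congʳ ([]·-no (t ≤ᶠ? i) t≰i)) (+-identityˡ _) ⟩
        [ t≟k t ]· exponent j t
      ≡⟨ ≡.cong (λ a → [ t≟k t ]· (lookup cs t -ₙ a)) (≡.sym (alpha-incAt-≰ j t≰i)) ⟩
        [ t≟k t ]· exponent (incAt i j) t ∎
    ... | yes t≤i = begin
        [ t ≤ᶠ? i ]· [ t≟k t ]· - 1# + [ t≟k t ]· exponent j t
      ≈⟨ trans (+-congʳ ([]·-yes (t ≤ᶠ? i) t≤i)) (sym ([]·-+ (t≟k t))) ⟩
        [ t≟k t ]· (- 1# + exponent j t)
      ≈⟨ []·-congʳ (t≟k t) (-1+[x-ₙa]≈x-ₙ1+a (lookup cs t) (alpha R j t)) ⟩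
        [ t≟k t ]· (lookup cs t -ₙ suc (alpha R j t))
      ≡⟨ ≡.cong (λ a → [ t≟k t ]· (lookup cs t -ₙ a)) (≡.sym (alpha-incAt-≤ j t≤i)) ⟩
        [ t≟k t ]· exponent (incAt i j) t ∎

  dMono-rhsMono : ∀ {n} (cs : Vec Carrier n) j →
                  dMono R (rhsMono R cs j) ∼ map (λ i → (lookup cs i -ₙ alpha R j i , rhsMono R cs (incAt i j))) (indices n)
  dMono-rhsMono {n} cs j =
    ≋-trans (dMono-leibniz (rhsMono R cs j))
      (≡.subst (_∼ map (λ i → (lookup cs i -ₙ alpha R j i , rhsMono R cs (incAt i j))) (indices n))
               (≡.sym (≡.trans (≡.cong (map (λ f → (proj₂ f , dlogℓ (proj₁ f) ++ rhsMono R cs j)))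
                                         (toList-tabulate (λ i → (ℤ.+ toℕ i , lookup cs i -ₙ alpha R j i))))
                                (≡.sym (Lₚ.map-∘ (indices n)))))
               (map-∼ (indices n) (λ _ → refl) (λ {i} _ → dlogℓ-rhsMono cs i j)))

  columnWeight : Carrier → List ℕ → Carrier
  columnWeight x = L.foldr (λ e acc → (x -ₙ e) * acc) 1#

  -- The sum of ∏ₜ (x -ₙ eₜ) over lo ≤ e₀ < e₁ < ⋯ < e_{h-1} with eₜ < lo + s + t,
  -- defined by splitting off the case e₀ = lo.
  columnPoly : Carrier → (h lo s : ℕ) → Carrier
  columnPoly x zero    lo s       = 1#
  columnPoly x (suc h) lo zero    = 0#
  columnPoly x (suc h) lo (suc s) = (x -ₙ lo) * columnPoly x h (suc lo) (suc s) + columnPoly x (suc h) (suc lo) s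

  -- The same sum split according to whether the last entry takes its largest value lo + s + h.
  columnPoly-last : ∀ x h lo s →
    columnPoly x (suc h) lo (suc s) ≈ columnPoly x (suc h) lo s + (x -ₙ (lo +ℕ s +ℕ h)) * columnPoly x h lo (suc s)
  columnPoly-last x zero lo zero =
    trans (+-identityʳ _)
          (trans (*-congʳ (-ₙ-congʳ x (≡.sym (≡.trans (Natₚ.+-identityʳ (lo +ℕ 0)) (Natₚ.+-identityʳ lo)))))
                 (sym (+-identityˡ _)))
  columnPoly-last x zero lo (suc s) =
    trans (+-congˡ (columnPoly-last x zero (suc lo) s))
          (trans (sym (+-assoc _ _ _)) (+-congˡ (*-congʳ (-ₙ-congʳ x (≡.cong (_+ℕ 0) (≡.sym (Natₚ.+-suc lo s)))))))
  columnPoly-last x (suc h) lo zero = begin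
      a * columnPoly x (suc h) (suc lo) 1 + 0#
    ≈⟨ trans (+-identityʳ _) (*-congˡ (trans (columnPoly-last x h (suc lo) 0) (+-identityˡ _))) ⟩
      a * (w * q)
    ≈⟨ x*[y*z]≈y*[x*z] a w q ⟩
      w * (a * q)
    ≈⟨ sym (trans (+-identityˡ _) (*-cong (-ₙ-congʳ x (Natₚ.+-suc (lo +ℕ 0) h)) (+-identityʳ _))) ⟩
      0# + (x -ₙ (lo +ℕ 0 +ℕ suc h)) * (a * q + 0#) ∎
    where
    a = x -ₙ lo
    w = x -ₙ (suc lo +ℕ 0 +ℕ h)
    q = columnPoly x h (suc lo) 1
    x*[y*z]≈y*[x*z] : ∀ x y z → x * (y * z) ≈ y * (x * z)
    x*[y*z]≈y*[x*z] = solve 3 (λ x y z → x :* (y :* z) := y :* (x :* z)) refl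
  columnPoly-last x (suc h) lo (suc s) = begin
      a * columnPoly x (suc h) (suc lo) (suc (suc s)) + columnPoly x (suc (suc h)) (suc lo) (suc s)
    ≈⟨ +-cong (*-congˡ (columnPoly-last x h (suc lo) (suc s))) (columnPoly-last x (suc h) (suc lo) s) ⟩
      a * (p + w₁ * q) + (t + w₂ * p)
    ≈⟨ +-cong (*-congˡ (+-congˡ (*-congʳ (-ₙ-congʳ x top₁)))) (+-congˡ (*-congʳ (-ₙ-congʳ x top₂))) ⟩
      a * (p + w * q) + (t + w * p)
    ≈⟨ solve 5 (λ a p w q t → a :* (p :+ w :* q) :+ (t :+ w :* p) := (a :* p :+ t) :+ w :* (a :* q :+ p)) refl a p w q t ⟩
      (a * p + t) + w * (a * q + p) ∎
    where
    a  = x -ₙ lo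
    w₁ = x -ₙ (suc lo +ℕ suc s +ℕ h)
    w₂ = x -ₙ (suc lo +ℕ s +ℕ suc h)
    w  = x -ₙ (lo +ℕ suc s +ℕ suc h)
    p  = columnPoly x (suc h) (suc lo) (suc s)
    q  = columnPoly x h (suc lo) (suc (suc s))
    t  = columnPoly x (suc (suc h)) (suc lo) s
    top₁ : suc lo +ℕ suc s +ℕ h ≡ lo +ℕ suc s +ℕ suc h
    top₁ = ≡.sym (Natₚ.+-suc (lo +ℕ suc s) h)
    top₂ : suc lo +ℕ s +ℕ suc h ≡ lo +ℕ suc s +ℕ suc h
    top₂ = ≡.cong (_+ℕ suc h) (≡.sym (Natₚ.+-suc lo s))

  -- The factor of a column of height h in [m₀,…,m_N]₁, B being the number of cells to its right.
  column : Carrier → (h B : ℕ) → Carrier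
  column x h B = columnPoly x h 0 (suc B)

  column-suc-zero : ∀ x h → column x (suc h) 0 ≈ (x -ₙ h) * column x h 0
  column-suc-zero x h = trans (columnPoly-last x h 0 0) (+-identityˡ _)

  column-suc-suc : ∀ x h B → column x (suc h) (suc B) ≈ column x (suc h) B + (x -ₙ (suc B +ℕ h)) * column x h (suc B)
  column-suc-suc x h B = columnPoly-last x h 0 (suc B)

  boundedWeight : Carrier → (B lo k : ℕ) → List ℕ → Carrier
  boundedWeight x B lo k []      = 1#
  boundedWeight x B lo k (e ∷ r) = [ lo ≤? e ]· [ e ≤? k +ℕ B ]· ((x -ₙ e) * boundedWeight x B (suc e) (suc k) r)

  startsFrom : ℕ → List ℕ → Bool
  startsFrom lo []      = true
  startsFrom lo (e ∷ _) = lo Nat.≤ᵇ e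

  strictlyIncreasing-∷ : ∀ e r → strictlyIncreasing (e ∷ r) ≡ startsFrom (suc e) r ∧ strictlyIncreasing r
  strictlyIncreasing-∷ e []      = ≡.refl
  strictlyIncreasing-∷ e (_ ∷ _) = ≡.refl

  boundedWeight-valid : ∀ x B lo k col →
    (if startsFrom lo col ∧ (strictlyIncreasing col ∧ boundedCol B k col) then columnWeight x col else 0#)
      ≈ boundedWeight x B lo k col
  boundedWeight-valid x B lo k []      = refl
  boundedWeight-valid x B lo k (e ∷ r) rewrite strictlyIncreasing-∷ e r with lo Nat.≤ᵇ e | e Nat.≤ᵇ k +ℕ B
  ... | false | _     = refl
  ... | true  | false rewrite ∧-zeroʳ (startsFrom (suc e) r ∧ strictlyIncreasing r) = refl
  ... | true  | true  rewrite ∧-assoc (startsFrom (suc e) r) (strictlyIncreasing r) (boundedCol B (suc k) r) =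
    trans (if-* (startsFrom (suc e) r ∧ (strictlyIncreasing r ∧ boundedCol B (suc k) r)))
          (*-congˡ (boundedWeight-valid x B (suc e) (suc k) r))
    where
    if-* : ∀ b → (if b then (x -ₙ e) * columnWeight x r else 0#) ≈ (x -ₙ e) * (if b then columnWeight x r else 0#)
    if-* true  = refl
    if-* false = sym (zeroʳ _)

  ∑-from : ∀ (g : ℕ → Carrier) {b} lo → lo < b →
           ∑[ t < b ] ([ lo ≤? toℕ t ]· g (toℕ t)) ≈ g lo + ∑[ t < b ] ([ suc lo ≤? toℕ t ]· g (toℕ t))
  ∑-from g {suc b} zero    _ = +-congˡ (sym (+-identityˡ _))
  ∑-from g {suc b} (suc lo) (s≤s lo<b) = begin
      0# + ∑[ t < b ] ([ suc lo ≤? suc (toℕ t) ]· g (suc (toℕ t)))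
    ≈⟨ trans (+-identityˡ _) (sum-cong-≋ {b} (λ t → []·-⇔ (suc lo ≤? suc (toℕ t)) (lo ≤? toℕ t) Natₚ.≤-pred s≤s)) ⟩
      ∑[ t < b ] ([ lo ≤? toℕ t ]· g (suc (toℕ t)))
    ≈⟨ ∑-from (g ∘ suc) lo lo<b ⟩
      g (suc lo) + ∑[ t < b ] ([ suc lo ≤? toℕ t ]· g (suc (toℕ t)))
    ≈⟨ +-congˡ (sum-cong-≋ {b} (λ t → []·-⇔ (suc lo ≤? toℕ t) (suc (suc lo) ≤? suc (toℕ t)) s≤s Natₚ.≤-pred)) ⟩
      g (suc lo) + ∑[ t < b ] ([ suc (suc lo) ≤? suc (toℕ t) ]· g (suc (toℕ t)))
    ≈⟨ +-congˡ (sym (+-identityˡ _)) ⟩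
      g (suc lo) + (0# + ∑[ t < b ] ([ suc (suc lo) ≤? suc (toℕ t) ]· g (suc (toℕ t)))) ∎

  module _ (x : Carrier) (B b : ℕ) where

    boundedSum : (h k lo : ℕ) → Carrier
    boundedSum h k lo = sumOver (boundedWeight x B lo k) (listsBelow h b)

    boundedSum-suc : ∀ h k lo → boundedSum (suc h) k lo ≈
      ∑[ e < b ] ([ lo ≤? toℕ e ]· [ toℕ e ≤? k +ℕ B ]· ((x -ₙ toℕ e) * boundedSum h (suc k) (suc (toℕ e))))
    boundedSum-suc h k lo = begin
        sumOver (boundedWeight x B lo k) (concatMap (λ e → map (e ∷_) (listsBelow h b)) (upTo b))
      ≈⟨ sumOver-concatMap _ _ (upTo b) ⟩
        sumOver (λ e → sumOver (boundedWeight x B lo k) (map (e ∷_) (listsBelow h b))) (upTo b)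
      ≈⟨ sumOver-cong (upTo b) (λ {e} _ → trans (reflexive (sumOver-map _ (e ∷_) (listsBelow h b))) (head e)) ⟩
        sumOver (λ e → [ lo ≤? e ]· [ e ≤? k +ℕ B ]· ((x -ₙ e) * boundedSum h (suc k) (suc e))) (upTo b)
      ≈⟨ sumOver-upTo _ b ⟩
        ∑[ e < b ] ([ lo ≤? toℕ e ]· [ toℕ e ≤? k +ℕ B ]· ((x -ₙ toℕ e) * boundedSum h (suc k) (suc (toℕ e)))) ∎
      where
      head : ∀ e → sumOver (λ r → boundedWeight x B lo k (e ∷ r)) (listsBelow h b) ≈
                   [ lo ≤? e ]· [ e ≤? k +ℕ B ]· ((x -ₙ e) * boundedSum h (suc k) (suc e))
      head e = trans (sumOver-[]· (lo ≤? e) _ (listsBelow h b)) ([]·-congʳ (lo ≤? e)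
               (trans (sumOver-[]· (e ≤? k +ℕ B) _ (listsBelow h b)) ([]·-congʳ (e ≤? k +ℕ B)
                      (*-distribˡ-sumOver (x -ₙ e) _ (listsBelow h b)))))

    boundedSum-empty : ∀ h k lo → k +ℕ B < lo → boundedSum (suc h) k lo ≈ 0#
    boundedSum-empty h k lo top<lo =
      trans (boundedSum-suc h k lo) (trans (sum-cong-≋ {b} outside) (sum-replicate-zero b))
      where
      outside : ∀ e → [ lo ≤? toℕ e ]· [ toℕ e ≤? k +ℕ B ]· ((x -ₙ toℕ e) * boundedSum h (suc k) (suc (toℕ e))) ≈ 0#
      outside e with lo ≤? toℕ e
      ... | no  lo≰e = []·-no (lo ≤? toℕ e) lo≰e
      ... | yes lo≤e = trans ([]·-yes (lo ≤? toℕ e) lo≤e) ([]·-no (toℕ e ≤? k +ℕ B)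
                         (λ e≤top → Natₚ.<-irrefl ≡.refl (Natₚ.<-≤-trans top<lo (Natₚ.≤-trans lo≤e e≤top))))

    boundedSum-step : ∀ h k lo → lo ≤ k +ℕ B → k +ℕ B < b →
      boundedSum (suc h) k lo ≈ (x -ₙ lo) * boundedSum h (suc k) (suc lo) + boundedSum (suc h) k (suc lo)
    boundedSum-step h k lo lo≤top top<b = begin
        boundedSum (suc h) k lo
      ≈⟨ boundedSum-suc h k lo ⟩
        ∑[ e < b ] ([ lo ≤? toℕ e ]· g (toℕ e))
      ≈⟨ ∑-from g lo (Natₚ.≤-<-trans lo≤top top<b) ⟩
        g lo + ∑[ e < b ] ([ suc lo ≤? toℕ e ]· g (toℕ e))
      ≈⟨ +-cong ([]·-yes (lo ≤? k +ℕ B) lo≤top) (sym (boundedSum-suc h k (suc lo))) ⟩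
        (x -ₙ lo) * boundedSum h (suc k) (suc lo) + boundedSum (suc h) k (suc lo) ∎
      where
      g : ℕ → Carrier
      g e = [ e ≤? k +ℕ B ]· ((x -ₙ e) * boundedSum h (suc k) (suc e))

    boundedSum≈columnPoly : ∀ h k lo s → lo +ℕ s ≡ suc (k +ℕ B) → k +ℕ B +ℕ h ≤ b →
                            boundedSum h k lo ≈ columnPoly x h lo s
    boundedSum≈columnPoly zero    k lo s       _  _     = +-identityʳ 1#
    boundedSum≈columnPoly (suc h) k lo zero    eq _     =
      boundedSum-empty h k lo (Natₚ.≤-reflexive (≡.trans (≡.sym eq) (Natₚ.+-identityʳ lo)))
    boundedSum≈columnPoly (suc h) k lo (suc s) eq bound =
      trans (boundedSum-step h k lo lo≤top (Natₚ.<-≤-trans (Natₚ.m<m+n (k +ℕ B) (s≤s z≤n)) bound))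
            (+-cong (*-congˡ (boundedSum≈columnPoly h (suc k) (suc lo) (suc s) (≡.cong suc eq) bound′))
                    (boundedSum≈columnPoly (suc h) k (suc lo) s (≡.trans (≡.sym (Natₚ.+-suc lo s)) eq) bound))
      where
      lo≤top : lo ≤ k +ℕ B
      lo≤top = ≡.subst (lo ≤_) (Natₚ.suc-injective (≡.trans (≡.sym (Natₚ.+-suc lo s)) eq)) (Natₚ.m≤m+n lo s)
      bound′ : suc k +ℕ B +ℕ h ≤ b
      bound′ = ≡.subst (_≤ b) (Natₚ.+-suc (k +ℕ B) h) bound

  columnSum : ∀ x h B → sumOver (columnWeight x) (filterᵇ (validColumn B) (listsBelow h (h +ℕ B))) ≈ column x h B
  columnSum x h B = begin
      sumOver (columnWeight x) (filterᵇ (validColumn B) (listsBelow h (h +ℕ B)))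
    ≈⟨ sumOver-filterᵇ (validColumn B) (columnWeight x) (listsBelow h (h +ℕ B)) ⟩
      sumOver (λ col → if validColumn B col then columnWeight x col else 0#) (listsBelow h (h +ℕ B))
    ≈⟨ sumOver-cong (listsBelow h (h +ℕ B)) (λ {col} _ → trans (reflexive (valid≡ col)) (boundedWeight-valid x B 0 0 col)) ⟩
      boundedSum x B (h +ℕ B) h 0 0
    ≈⟨ boundedSum≈columnPoly x B (h +ℕ B) h 0 0 (suc B) ≡.refl (Natₚ.≤-reflexive (Natₚ.+-comm B h)) ⟩
      column x h B ∎
    where
    valid≡ : ∀ col → (if validColumn B col then columnWeight x col else 0#) ≡
                     (if startsFrom 0 col ∧ validColumn B col then columnWeight x col else 0#)
    valid≡ []      = ≡.refl
    valid≡ (_ ∷ _) = ≡.refl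

  bracket₁-∷ : ∀ h hs x xs → bracket₁ R (h ∷ hs) (x ∷ xs) ≈ column x h (sumℕ hs) * bracket₁ R hs xs
  bracket₁-∷ h hs x xs = begin
      sumOver (λ t → tabWeight R t (x ∷ xs)) (concatMap (λ col → map (col ∷_) T) C)
    ≈⟨ sumOver-concatMap _ _ C ⟩
      sumOver (λ col → sumOver (λ t → tabWeight R t (x ∷ xs)) (map (col ∷_) T)) C
    ≈⟨ sumOver-cong C (λ {col} _ → trans (reflexive (sumOver-map _ (col ∷_) T)) (*-distribˡ-sumOver (columnWeight x col) _ T)) ⟩
      sumOver (λ col → columnWeight x col * bracket₁ R hs xs) C
    ≈⟨ *-distribʳ-sumOver _ _ C ⟩
      sumOver (columnWeight x) C * bracket₁ R hs xs
    ≈⟨ *-congʳ (columnSum x h (sumℕ hs)) ⟩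
      column x h (sumℕ hs) * bracket₁ R hs xs ∎
    where
    T = tableaux hs
    C = filterᵇ (validColumn (sumℕ hs)) (listsBelow h (h +ℕ sumℕ hs))

  tableauProduct : ∀ {n} → Vec ℕ n → Vec Carrier n → Carrier
  tableauProduct []       []       = 1#
  tableauProduct (h ∷ hs) (x ∷ xs) = column x h (total hs) * tableauProduct hs xs

  bracket₁≈tableauProduct : ∀ {n} (y : Vec ℕ n) cs → bracket₁ R (toList y) (toList cs) ≈ tableauProduct y cs
  bracket₁≈tableauProduct []       []       = +-identityʳ 1#
  bracket₁≈tableauProduct (h ∷ hs) (x ∷ xs) =
    trans (bracket₁-∷ h (toList hs) x (toList xs)) (*-congˡ (bracket₁≈tableauProduct hs xs))

  tableauProduct-zero : ∀ {n} (y : Vec ℕ n) cs → total y ≡ 0 → tableauProduct y cs ≈ 1#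
  tableauProduct-zero []         []       _  = refl
  tableauProduct-zero (zero ∷ y) (x ∷ cs) eq = trans (*-identityˡ _) (tableauProduct-zero y cs eq)

  whenPositive : ℕ → Carrier → Carrier
  whenPositive zero    _ = 0#
  whenPositive (suc _) v = v

  -- The contribution of removing the bottom cell of column i.
  removalTerm : ∀ {n} → Vec ℕ n → Vec Carrier n → Fin n → Carrier
  removalTerm y cs i = whenPositive (lookup y i) (tableauProduct (decAt i y) cs * (lookup cs i -ₙ alpha R (decAt i y) i))

  private
    whenPositive-zero : ∀ {n} (y : Vec ℕ n) i {v} → total y ≡ 0 → whenPositive (lookup y i) v ≈ 0#
    whenPositive-zero y i eq with lookup y i | lookup≤total y i
    ... | zero  | _ = refl
    ... | suc _ | le with ≡.subst (suc _ ≤_) eq le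
    ...   | ()

    removalTerm-suc : ∀ {n} h (ys : Vec ℕ n) x xs {B} → total ys ≡ suc B → ∀ i →
                      removalTerm (h ∷ ys) (x ∷ xs) (Fin.suc i) ≈ column x h B * removalTerm ys xs i
    removalTerm-suc h ys x xs eq i with lookup ys i in yᵢ
    ... | zero  = sym (zeroʳ _)
    ... | suc _ = trans (*-assoc _ _ _) (*-congʳ (reflexive (≡.cong (column x h) (total-decAt i ys yᵢ eq))))

    ∑-removalTerm-suc : ∀ {n} h (ys : Vec ℕ n) x xs {B} → total ys ≡ suc B →
                        tableauProduct ys xs ≈ ∑[ i < n ] removalTerm ys xs i →
                        ∑[ i < n ] removalTerm (h ∷ ys) (x ∷ xs) (Fin.suc i) ≈ column x h B * tableauProduct ys xs
    ∑-removalTerm-suc {n} h ys x xs eq ih =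
      trans (sum-cong-≋ {n} (removalTerm-suc h ys x xs eq)) (trans (sym (*-distribˡ-sum {n} _ _)) (*-congˡ (sym ih)))

  tableauProduct-rec : ∀ {n} m (y : Vec ℕ n) cs → total y ≡ suc m → tableauProduct y cs ≈ ∑[ i < n ] removalTerm y cs i
  tableauProduct-rec m (zero ∷ ys) (x ∷ xs) eq =
    trans (sym (+-identityˡ _)) (+-congˡ (sym (∑-removalTerm-suc 0 ys x xs eq (tableauProduct-rec _ ys xs eq))))
  tableauProduct-rec {suc n} m (suc h ∷ ys) (x ∷ xs) eq = lastColumn (total ys) ≡.refl
    where
    F = tableauProduct ys xs
    lastColumn : ∀ B → total ys ≡ B →
                 tableauProduct (suc h ∷ ys) (x ∷ xs) ≈ ∑[ i < suc n ] removalTerm (suc h ∷ ys) (x ∷ xs) i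
    lastColumn zero eqB = begin
        column x (suc h) (total ys) * F
      ≈⟨ *-cong (reflexive (≡.cong (column x (suc h)) eqB)) (tableauProduct-zero ys xs eqB) ⟩
        column x (suc h) 0 * 1#
      ≈⟨ *-congʳ (column-suc-zero x h) ⟩
        ((x -ₙ h) * column x h 0) * 1#
      ≈⟨ solve 2 (λ w q → (w :* q) :* con 1 := (q :* con 1) :* w) refl (x -ₙ h) (column x h 0) ⟩
        (column x h 0 * 1#) * (x -ₙ h)
      ≈⟨ sym (*-cong (*-cong (reflexive (≡.cong (column x h) eqB)) (tableauProduct-zero ys xs eqB))
                     (-ₙ-congʳ x (≡.trans (≡.cong (h +ℕ_) eqB) (Natₚ.+-identityʳ h)))) ⟩
        (column x h (total ys) * F) * (x -ₙ (h +ℕ total ys))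
      ≈⟨ sym (trans (+-congˡ (trans (sum-cong-≋ {n} (λ i → whenPositive-zero ys i eqB)) (sum-replicate-zero n))) (+-identityʳ _)) ⟩
        (column x h (total ys) * F) * (x -ₙ (h +ℕ total ys)) + ∑[ i < n ] removalTerm (suc h ∷ ys) (x ∷ xs) (Fin.suc i) ∎
    lastColumn (suc B) eqB = begin
        column x (suc h) (total ys) * F
      ≈⟨ *-congʳ (trans (reflexive (≡.cong (column x (suc h)) eqB)) (column-suc-suc x h B)) ⟩
        (p + w * q) * F
      ≈⟨ solve 4 (λ p w q f → (p :+ w :* q) :* f := (q :* f) :* w :+ p :* f) refl p w q F ⟩
        (q * F) * w + p * F
      ≈⟨ +-cong (sym (*-cong (*-congʳ (reflexive (≡.cong (column x h) eqB)))
                             (-ₙ-congʳ x (≡.trans (≡.cong (h +ℕ_) eqB) (Natₚ.+-comm h (suc B))))))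
                (sym (∑-removalTerm-suc (suc h) ys x xs eqB (tableauProduct-rec B ys xs eqB))) ⟩
        (column x h (total ys) * F) * (x -ₙ (h +ℕ total ys)) + ∑[ i < n ] removalTerm (suc h ∷ ys) (x ∷ xs) (Fin.suc i) ∎
      where
      p = column x (suc h) B
      w = x -ₙ (suc B +ℕ h)
      q = column x h (suc B)

  module _ {n} (cs : Vec Carrier n) where

    private
      F : Vec ℕ n → Carrier
      F y = tableauProduct y cs

      _≟ᵛ_ : DecidableEquality (Vec ℕ n)
      _≟ᵛ_ = Vₚ.≡-dec Natₚ._≟_

      raise : Vec ℕ n × Fin n → Vec ℕ n
      raise p = incAt (proj₂ p) (proj₁ p)

      termCoefficient : Vec ℕ n × Fin n → Carrier
      termCoefficient p = F (proj₁ p) * (lookup cs (proj₂ p) -ₙ alpha R (proj₁ p) (proj₂ p))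

      pairs : ℕ → List (Vec ℕ n × Fin n)
      pairs m = concatMap (λ j → map (j ,_) (indices n)) (compositions n m)

      raise-pairs : ∀ m {p} → p ∈ pairs m → raise p ∈ compositions n (suc m)
      raise-pairs m p∈ with find (∈-concatMap⁻ (λ j → map (j ,_) (indices n)) {xs = compositions n m} p∈)
      ... | j , j∈ , p∈′ with ∈-map⁻ (j ,_) p∈′
      ...   | i , _ , ≡.refl =
        ∈-compositions⁺ (suc m) (incAt i j) (≡.trans (total-incAt i j) (≡.cong suc (∈-compositions⁻ m j j∈)))

      expandTerm : Vec ℕ n → Elem R
      expandTerm j = map (λ i → (termCoefficient (j , i) , rhsMono R cs (incAt i j))) (indices n)

      dElem-rhs-expanded : ∀ m → dElem R (rhs R n m cs) ∼ map (λ p → (termCoefficient p , rhsMono R cs (raise p))) (pairs m)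
      dElem-rhs-expanded m =
        ≋-trans (∼-reflexive (Lₚ.concatMap-map dTerm bracketTerm (compositions n m)))
          (≋-trans (concatMap-∼ (compositions n m) (λ {j} _ → expand j))
                   (∼-reflexive (≡.trans (Lₚ.concatMap-cong (λ j → Lₚ.map-∘ (indices n)) (compositions n m))
                                         (≡.sym (Lₚ.map-concatMap _ (λ j → map (j ,_) (indices n)) (compositions n m))))))
        where
        dTerm : Carrier × Mono R → Elem R
        dTerm t = scale (proj₁ t) (dMono R (proj₂ t))
        bracketTerm : Vec ℕ n → Carrier × Mono R
        bracketTerm j = (bracket₁ R (toList j) (toList cs) , rhsMono R cs j)
        expand : ∀ j → dTerm (bracketTerm j) ∼ expandTerm j
        expand j = ≋-trans (scale-congˡ _ (bracket₁≈tableauProduct j cs))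
                     (≋-trans (scale-cong (F j) (dMono-rhsMono cs j)) (∼-reflexive (≡.sym (Lₚ.map-∘ (indices n)))))

      coefficient-raise : ∀ m {y} → y ∈ compositions n (suc m) →
                          coefficientOf _≟ᵛ_ raise termCoefficient (rhsMono R cs) (pairs m) y ≈ F y
      coefficient-raise m {y} y∈ = begin
          sumOver (λ p → [ raise p ≟ᵛ y ]· termCoefficient p) (pairs m)
        ≈⟨ sumOver-concatMap _ _ (compositions n m) ⟩
          sumOver (λ j → sumOver (λ p → [ raise p ≟ᵛ y ]· termCoefficient p) (map (j ,_) (indices n))) (compositions n m)
        ≈⟨ sumOver-cong (compositions n m) (λ {j} _ → reflexive (≡.trans (sumOver-map _ (j ,_) (indices n))
             (sumOver-tabulate {n = n} (λ i → [ incAt i j ≟ᵛ y ]· termCoefficient (j , i)) id))) ⟩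
          sumOver (λ j → ∑[ i < n ] ([ incAt i j ≟ᵛ y ]· termCoefficient (j , i))) (compositions n m)
        ≈⟨ sumOver-∑ {n = n} (λ j i → [ incAt i j ≟ᵛ y ]· termCoefficient (j , i)) (compositions n m) ⟩
          ∑[ i < n ] sumOver (λ j → [ incAt i j ≟ᵛ y ]· termCoefficient (j , i)) (compositions n m)
        ≈⟨ sum-cong-≋ {n} fromColumn ⟩
          ∑[ i < n ] removalTerm y cs i
        ≈⟨ sym (tableauProduct-rec m y cs total≡) ⟩
          F y ∎
        where
        total≡ : total y ≡ suc m
        total≡ = ∈-compositions⁻ (suc m) y y∈
        fromColumn : ∀ i → sumOver (λ j → [ incAt i j ≟ᵛ y ]· termCoefficient (j , i)) (compositions n m) ≈ removalTerm y cs i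
        fromColumn i with lookup y i in yᵢ
        ... | zero  = sumOver-zero (compositions n m) (λ {j} _ → []·-no (incAt i j ≟ᵛ y) λ incAt≡y →
                        Natₚ.0≢1+n (≡.trans (≡.sym yᵢ) (≡.trans (≡.cong (λ v → lookup v i) (≡.sym incAt≡y)) (lookup-incAt i j))))
        ... | suc _ =
          sumOver-single _≟ᵛ_ (incAt i) (λ j → termCoefficient (j , i)) (compositions n m) (compositions-unique n m)
            (∈-compositions⁺ m (decAt i y) (total-decAt i y yᵢ total≡)) (incAt-decAt i y yᵢ)
            (λ {j} incAt≡y → ≡.trans (≡.sym (decAt-incAt i j)) (≡.cong (decAt i) incAt≡y))

    initial : [ (1# , lhsMono R cs) ] ∼ rhs R n 0 cs
    initial =
      ≋-trans (≋-cons (sym (trans (bracket₁≈tableauProduct zeros cs) (tableauProduct-zero zeros cs (total-replicate n))))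
                      (lhsMono≃rhsMono cs)
                      ≋-refl)
              (∼-reflexive (≡.cong (map (λ j → (bracket₁ R (toList j) (toList cs) , rhsMono R cs j)))
                                   (≡.sym (compositions-zero n))))
      where
      zeros = V.replicate n 0

    dElem-rhs : ∀ m → dElem R (rhs R n m cs) ∼ rhs R n (suc m) cs
    dElem-rhs m =
      ≋-trans (dElem-rhs-expanded m)
        (≋-trans (collect _≟ᵛ_ raise termCoefficient (rhsMono R cs) (compositions n (suc m)) (compositions-unique n (suc m))
                          (pairs m) (raise-pairs m))
                 (map-∼ (compositions n (suc m)) (λ {y} y∈ → trans (coefficient-raise m y∈) (sym (bracket₁≈tableauProduct y cs)))
                        (λ {y} _ → ≃-refl {rhsMono R cs y})))


mainTheorem5 : ∀ {c ℓ : Level} (R : CommutativeRing c ℓ) (N m : ℕ)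
                 (cs : Vec (CommutativeRing.Carrier R) (suc N)) →
                 _≋_ R (dPow R m [ (CommutativeRing.1# R , lhsMono R cs) ])
                       (rhs R (suc N) m cs)
mainTheorem5 R N zero    cs = Expansion.initial R cs
mainTheorem5 R N (suc m) cs = ≋-trans (Expansion.dElem-cong R (mainTheorem5 R N m cs)) (Expansion.dElem-rhs R cs m)
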